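{- Let $n\ge 3$ and let $\prec$ be a uniform linear ordering of $[k]^n$. Let $<$ be the linear ordering of $[k]$ induced by $\prec$ (i.e., the common restriction of $\prec$ to all $1$-subcubes). If $a,b\in[k]$ satisfy $a<b$, then the restriction of $\prec$ to $\{a,b\}^n$ is the lexicographic ordering of $\{a,b\}^n$ for the restriction of $<$ to $\{a,b\}$ (i.e., for distinct $w,w'\in\{a,b\}^n$, $w\prec w'$ iff $w_i=a$, $w'_i=b$ where $i$ is the least index with $w_i\ne w'_i$).
   Context: Elements of $[k]^n$ are words over $[k]=\{1,\dotsc,k\}$. A $d$-parameter word of length $n$ is a word $p$ over $[k]\cup\{*_1,\dotsc,*_d\}$ containing each $*_i$; $p[w]$ replaces each $*_i$ by $w_i$; $\{p[w]:w\in[k]^d\}$ is a $d$-subcube. Canonical words are those in which the first occurrences of $*_1,\dotsc,*_d$ appear in order; each subcube has a unique canonical word giving the canonical bijection $w\mapsto p[w]$. The restriction of $\prec$ to the subcube is the ordering on $[k]^d$ with $w\prec w'$ iff $p[w]\prec p[w']$. $\prec$ is uniform if for each $d$, all its restrictions to $d$-subcubes coincide as orderings of $[k]^d$. -}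

module Defs where

open import Data.Nat using (ℕ)
open import Data.Fin using (Fin; _<_)
open import Data.Vec using (Vec; lookup; map; replicate)
open import Data.Sum using (_⊎_; inj₁; inj₂; [_,_])
open import Data.Product using (Σ; _×_; ∃)
open import Function using (id)
open import Relation.Binary.PropositionalEquality using (_≡_; _≢_)
open import Relation.Nullary using (¬_)
open import Function.Bundles using (_⇔_)

Word : ℕ → ℕ → Set
Word k n = Vec (Fin k) n

-- d-parameter words of length n: letters are inj₁ a (a ∈ [k]) or inj₂ i (the star *_i).
PWord : ℕ → ℕ → ℕ → Set
PWord k d n = Vec (Fin k ⊎ Fin d) n

ContainsAllStars : ∀ {k d n} → PWord k d n → Set
ContainsAllStars {d = d} {n = n} p = (i : Fin d) → ∃ λ (pos : Fin n) → lookup p pos ≡ inj₂ i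

IsFirstOcc : ∀ {k d n} → PWord k d n → Fin d → Fin n → Set
IsFirstOcc {n = n} p i pos =
  lookup p pos ≡ inj₂ i × ((pos' : Fin n) → pos' < pos → lookup p pos' ≢ inj₂ i)

IsParamWord : ∀ {k d n} → PWord k d n → Set
IsParamWord p = ContainsAllStars p

IsCanonical : ∀ {k d n} → PWord k d n → Set
IsCanonical {d = d} {n = n} p =
  IsParamWord p ×
  ((i j : Fin d) (pi pj : Fin n) → i < j → IsFirstOcc p i pi → IsFirstOcc p j pj → pi < pj)

subst : ∀ {k d n} → PWord k d n → Word k d → Word k n
subst p w = map [ id , lookup w ] p

record IsLinearOrder {k n : ℕ} (_≺_ : Word k n → Word k n → Set) : Set where
  field
    irrefl : ∀ w → ¬ (w ≺ w)
    trans  : ∀ {u v w} → u ≺ v → v ≺ w → u ≺ w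
    total  : ∀ v w → v ≺ w ⊎ (v ≡ w ⊎ w ≺ v)

restrict : ∀ {k n d} → (Word k n → Word k n → Set) → PWord k d n → Word k d → Word k d → Set
restrict _≺_ p w w' = subst p w ≺ subst p w'

-- uniform: for each d, all restrictions to d-subcubes (indexed by their canonical words) coincide
IsUniform : ∀ {k n} → (Word k n → Word k n → Set) → Set
IsUniform {k} {n} _≺_ =
  (d : ℕ) (p q : PWord k d n) → IsCanonical p → IsCanonical q →
  (w w' : Word k d) → (restrict _≺_ p w w' ⇔ restrict _≺_ q w w')

-- the induced ordering of [k]: restriction of ≺ to the diagonal 1-subcube (word *_1 *_1 ... *_1),
-- which by uniformity equals the restriction to every 1-subcube.
diagonal : ∀ {k n} → PWord k 1 n
diagonal = replicate _ (inj₂ Fin.zero)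
  where import Data.Fin as Fin

induced : ∀ {k n} → (Word k n → Word k n → Set) → Fin k → Fin k → Set
induced {k} {n} _≺_ a b = restrict _≺_ (diagonal {k} {n}) (replicate 1 a) (replicate 1 b)

InAB : ∀ {k n} → Fin k → Fin k → Word k n → Set
InAB {n = n} a b w = (i : Fin n) → lookup w i ≡ a ⊎ lookup w i ≡ b

LexAB : ∀ {k n} → Fin k → Fin k → Word k n → Word k n → Set
LexAB {n = n} a b w w' =
  ∃ λ (i : Fin n) →
    ((j : Fin n) → j < i → lookup w j ≡ lookup w' j) ×
    lookup w i ≡ a × lookup w' i ≡ b

-- On a two-letter alphabet a < b, any two distinct words u, v whose first difference has a in u
-- and b in v are p[a], p[b] for a canonical 1-parameter word p (when no position carries b in u
-- and a in v), or p[ab], p[ba] for a canonical 2-parameter word p (otherwise). The first kind is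
-- ordered by the induced order a < b. For the second, uniformity says that either every
-- 2-subcube orders ab before ba or every one orders ba before ab; the latter would give the cycle
-- aab… ≺ bab… ≺ aba… ≺ bba… ≺ aab… (padding with the third letter): its first and third steps
-- change only the first letter, and its other steps are ba ≺ ab in the 2-subcubes {xyx…} and
-- {xxy…}. This is where n ≥ 3 is needed.
module Submission where

open import Defs
open import Data.Bool using (Bool; true; false; f≤t; b≤b) renaming (_≤_ to _≤ᵇ_)
open import Data.Nat using (ℕ; _+_; _≥_; suc; s≤s; z≤n)
import Data.Nat.Properties as ℕ
open import Data.Fin using (Fin; zero; suc; _<_; _≟_)
import Data.Fin.Properties as Fin
open import Data.Vec using (Vec; []; _∷_; lookup; map; replicate; zipWith)
open import Data.Vec.Properties using (lookup-map; lookup-zipWith; lookup-replicate; map-replicate)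
open import Data.Vec.Relation.Binary.Pointwise.Inductive using (Pointwise; []; _∷_)
open import Data.Sum using (_⊎_; inj₁; inj₂; [_,_]; [_,_]′)
import Data.Sum as Sum
open import Data.Product using (_×_; ∃; _,_; proj₁; proj₂)
open import Data.Empty using (⊥-elim)
open import Relation.Nullary using (yes; no)
open import Relation.Binary.Definitions using (DecidableEquality)
open import Relation.Binary.PropositionalEquality
  using (_≡_; _≢_; refl; sym; trans; cong; cong₂; subst₂; module ≡-Reasoning)
open import Function using (id)
open import Function.Bundles using (_⇔_; mk⇔; Equivalence)
open ≡-Reasoning

private
  variable
    A : Set
    k n d : ℕ

first-mismatch : DecidableEquality A → (xs ys : Vec A n) → xs ≢ ys →
  ∃ λ i → (∀ j → j < i → lookup xs j ≡ lookup ys j) × lookup xs i ≢ lookup ys i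
first-mismatch _≟ᴬ_ [] [] xs≢ys = ⊥-elim (xs≢ys refl)
first-mismatch _≟ᴬ_ (x ∷ xs) (y ∷ ys) xs≢ys with x ≟ᴬ y
... | no x≢y = zero , (λ _ ()) , x≢y
... | yes refl with first-mismatch _≟ᴬ_ xs ys (λ eq → xs≢ys (cong (x ∷_) eq))
...   | i , prefix , mismatch = suc i , prefix′ , mismatch
  where
  prefix′ : ∀ j → j < suc i → lookup (x ∷ xs) j ≡ lookup (y ∷ ys) j
  prefix′ zero    _         = refl
  prefix′ (suc j) (s≤s j<i) = prefix j j<i

*₀ : Fin k ⊎ Fin (suc d)
*₀ = inj₂ zero

*₁ : Fin k ⊎ Fin (suc (suc d))
*₁ = inj₂ (suc zero)

lookup-subst : (p : PWord k d n) (w : Word k d) (i : Fin n) →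
  lookup (subst p w) i ≡ [ id , lookup w ] (lookup p i)
lookup-subst p w i = lookup-map i _ p

canonical₁ : (p : PWord k 1 n) (i : Fin n) → lookup p i ≡ *₀ → IsCanonical p
canonical₁ p i pᵢ≡*₀ = (λ { zero → i , pᵢ≡*₀ }) , λ { zero zero _ _ () }

canonical₂ : (p : PWord k 2 n) (i j : Fin n) → lookup p i ≡ *₀ → lookup p j ≡ *₁ →
  (∀ l → lookup p l ≡ *₁ → i < l) → IsCanonical p
canonical₂ p i j pᵢ≡*₀ pⱼ≡*₁ *₁-after-i =
  (λ { zero → i , pᵢ≡*₀ ; (suc zero) → j , pⱼ≡*₁ }) , ordered
  where
  ordered : (s t : Fin 2) (l₀ l₁ : Fin _) → s < t → IsFirstOcc p s l₀ → IsFirstOcc p t l₁ → l₀ < l₁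
  ordered zero (suc zero) l₀ l₁ _ (_ , none-before-l₀) (p≡*₁ , _) =
    ℕ.≤-<-trans (ℕ.≮⇒≥ (λ i<l₀ → none-before-l₀ i i<l₀ pᵢ≡*₀)) (*₁-after-i l₁ p≡*₁)
  ordered zero       zero       _ _ ()
  ordered (suc zero) zero       _ _ ()
  ordered (suc zero) (suc zero) _ _ (s≤s ())

canonical₂-*₀∷ : (p : PWord k 2 n) (j : Fin n) → lookup p j ≡ *₁ → IsCanonical (*₀ ∷ p)
canonical₂-*₀∷ {n = n} p j pⱼ≡*₁ = canonical₂ (*₀ ∷ p) zero (suc j) refl pⱼ≡*₁ after-head
  where
  after-head : ∀ l → lookup (*₀ ∷ p) l ≡ *₁ → zero {n} < l
  after-head zero    ()
  after-head (suc l) _ = s≤s z≤n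

SubcubeImage : Word k d → Word k d → Word k n → Word k n → Set
SubcubeImage {n = n} w w′ u v =
  ∃ λ (p : PWord _ _ n) → IsCanonical p × subst p w ≡ u × subst p w′ ≡ v

module _ (_≺_ : Word k n → Word k n → Set) where

  image⇒≺ : (w w′ : Word k d) {u v : Word k n} →
    (∀ p → IsCanonical p → restrict _≺_ p w w′) → SubcubeImage w w′ u v → u ≺ v
  image⇒≺ _ _ ≺-everywhere (p , canonical , refl , refl) = ≺-everywhere p canonical

  induced⇒restrict₁ : IsUniform _≺_ → {a b : Fin k} → induced _≺_ a b →
    (p : PWord k 1 n) → IsCanonical p → restrict _≺_ p (a ∷ []) (b ∷ [])
  induced⇒restrict₁ uniform {a} {b} a<b p canonical@(star , _) =
    Equivalence.to (uniform 1 diagonal p diagonal-canonical canonical (a ∷ []) (b ∷ [])) a<b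
    where
    diagonal-canonical : IsCanonical (diagonal {k} {n})
    diagonal-canonical =
      canonical₁ diagonal (proj₁ (star zero)) (lookup-replicate (proj₁ (star zero)) *₀)

triple : {m : ℕ} → A → A → A → Vec A (3 + m)
triple {m = m} x y z = x ∷ y ∷ z ∷ replicate m z

map-triple : {B : Set} {m : ℕ} (f : A → B) (x y z : A) →
  map f (triple {m = m} x y z) ≡ triple (f x) (f y) (f z)
map-triple {m = m} f x y z = cong (λ zs → f x ∷ f y ∷ f z ∷ zs) (map-replicate f z m)

subst-triple : {m : ℕ} (w : Word k d) (l₀ l₁ l₂ : Fin k ⊎ Fin d) →
  subst (triple {m = m} l₀ l₁ l₂) w ≡
  triple ([ id , lookup w ] l₀) ([ id , lookup w ] l₁) ([ id , lookup w ] l₂)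
subst-triple w = map-triple [ id , lookup w ]

lookup-zipWith-at : {B C : Set} (f : A → B → C) (xs : Vec A n) (ys : Vec B n) (i : Fin n)
  {x : A} {y : B} → lookup xs i ≡ x → lookup ys i ≡ y → lookup (zipWith f xs ys) i ≡ f x y
lookup-zipWith-at f xs ys i xsᵢ≡x ysᵢ≡y = trans (lookup-zipWith f i xs ys) (cong₂ f xsᵢ≡x ysᵢ≡y)

true≢false : true ≢ false
true≢false ()

≤ᵇ-or-descent : ∀ s t → s ≤ᵇ t ⊎ (s ≡ true × t ≡ false)
≤ᵇ-or-descent false false = inj₁ b≤b
≤ᵇ-or-descent false true  = inj₁ f≤t
≤ᵇ-or-descent true  false = inj₂ (refl , refl)
≤ᵇ-or-descent true  true  = inj₁ b≤b

pointwise-≤-or-descent : (x y : Vec Bool n) →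
  Pointwise _≤ᵇ_ x y ⊎ ∃ λ j → lookup x j ≡ true × lookup y j ≡ false
pointwise-≤-or-descent []       []       = inj₁ []
pointwise-≤-or-descent (s ∷ xs) (t ∷ ys) with ≤ᵇ-or-descent s t
... | inj₂ descent = inj₂ (zero , descent)
... | inj₁ s≤t     =
  Sum.map (s≤t ∷_) (λ (j , descent) → suc j , descent) (pointwise-≤-or-descent xs ys)

module _ (a b : Fin k) where

  letter : Bool → Fin k
  letter false = a
  letter true  = b

  letter-injective : a ≢ b → ∀ {s t} → letter s ≡ letter t → s ≡ t
  letter-injective a≢b {false} {false} _   = refl
  letter-injective a≢b {false} {true}  a≡b = ⊥-elim (a≢b a≡b)
  letter-injective a≢b {true}  {false} b≡a = ⊥-elim (a≢b (sym b≡a))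
  letter-injective a≢b {true}  {true}  _   = refl

  InAB⇒binary : (w : Word k n) → InAB a b w → ∃ λ x → map letter x ≡ w
  InAB⇒binary []      _    = [] , refl
  InAB⇒binary (c ∷ w) w∈ab with InAB⇒binary w (λ i → w∈ab (suc i)) | w∈ab zero
  ... | x , refl | inj₁ refl = false ∷ x , refl
  ... | x , refl | inj₂ refl = true ∷ x , refl

  lexAB-binary : a ≢ b → (x y : Vec Bool n) → LexAB a b (map letter x) (map letter y) →
    ∃ λ i → (∀ j → j < i → lookup x j ≡ lookup y j) × lookup x i ≡ false × lookup y i ≡ true
  lexAB-binary a≢b x y (i , prefix , xᵢ≡a , yᵢ≡b) =
    i , (λ j j<i → injective (trans (sym (lookup-map j letter x))
                                    (trans (prefix j j<i) (lookup-map j letter y))))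
      , injective (trans (sym (lookup-map i letter x)) xᵢ≡a)
      , injective (trans (sym (lookup-map i letter y)) yᵢ≡b)
    where injective = letter-injective a≢b

  -- The value at (true, false) is junk: pattern₁ is only used when that pair does not occur.
  pattern₁ : Bool → Bool → Fin k ⊎ Fin 1
  pattern₁ false false = inj₁ a
  pattern₁ false true  = *₀
  pattern₁ true  false = inj₁ b
  pattern₁ true  true  = inj₁ b

  pattern₂ : Bool → Bool → Fin k ⊎ Fin 2
  pattern₂ false false = inj₁ a
  pattern₂ false true  = *₀
  pattern₂ true  false = *₁
  pattern₂ true  true  = inj₁ b

  subst-pattern₁ : {x y : Vec Bool n} → Pointwise _≤ᵇ_ x y →
    subst (zipWith pattern₁ x y) (a ∷ []) ≡ map letter x ×
    subst (zipWith pattern₁ x y) (b ∷ []) ≡ map letter y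
  subst-pattern₁ []            = refl , refl
  subst-pattern₁ (x≤y ∷ xs≤ys) =
    cong₂ _∷_ (proj₁ (at x≤y)) (proj₁ (subst-pattern₁ xs≤ys)) ,
    cong₂ _∷_ (proj₂ (at x≤y)) (proj₂ (subst-pattern₁ xs≤ys))
    where
    at : ∀ {s t} → s ≤ᵇ t →
      [ id , lookup (a ∷ []) ] (pattern₁ s t) ≡ letter s ×
      [ id , lookup (b ∷ []) ] (pattern₁ s t) ≡ letter t
    at f≤t           = refl , refl
    at (b≤b {false}) = refl , refl
    at (b≤b {true})  = refl , refl

  subst-pattern₂ : (x y : Vec Bool n) →
    subst (zipWith pattern₂ x y) (a ∷ b ∷ []) ≡ map letter x ×
    subst (zipWith pattern₂ x y) (b ∷ a ∷ []) ≡ map letter y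
  subst-pattern₂ []       []       = refl , refl
  subst-pattern₂ (s ∷ xs) (t ∷ ys) =
    cong₂ _∷_ (proj₁ (at s t)) (proj₁ (subst-pattern₂ xs ys)) ,
    cong₂ _∷_ (proj₂ (at s t)) (proj₂ (subst-pattern₂ xs ys))
    where
    at : ∀ s t →
      [ id , lookup (a ∷ b ∷ []) ] (pattern₂ s t) ≡ letter s ×
      [ id , lookup (b ∷ a ∷ []) ] (pattern₂ s t) ≡ letter t
    at false false = refl , refl
    at false true  = refl , refl
    at true  false = refl , refl
    at true  true  = refl , refl

  pattern₂≡*₁ : ∀ s t → pattern₂ s t ≡ *₁ → s ≡ true × t ≡ false
  pattern₂≡*₁ true  false _ = refl , refl
  pattern₂≡*₁ false false ()
  pattern₂≡*₁ false true  ()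
  pattern₂≡*₁ true  true  ()

  binary-lex⇒subcube-image : (x y : Vec Bool n) (i : Fin n) →
    (∀ j → j < i → lookup x j ≡ lookup y j) → lookup x i ≡ false → lookup y i ≡ true →
    SubcubeImage (a ∷ []) (b ∷ []) (map letter x) (map letter y) ⊎
    SubcubeImage (a ∷ b ∷ []) (b ∷ a ∷ []) (map letter x) (map letter y)
  binary-lex⇒subcube-image x y i prefix xᵢ≡false yᵢ≡true with pointwise-≤-or-descent x y
  ... | inj₁ x≤y =
    inj₁ ( zipWith pattern₁ x y
         , canonical₁ (zipWith pattern₁ x y) i (lookup-zipWith-at pattern₁ x y i xᵢ≡false yᵢ≡true)
         , subst-pattern₁ x≤y )
  ... | inj₂ (j , xⱼ≡true , yⱼ≡false) =
    inj₂ ( zipWith pattern₂ x y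
         , canonical₂ (zipWith pattern₂ x y) i j
             (lookup-zipWith-at pattern₂ x y i xᵢ≡false yᵢ≡true)
             (lookup-zipWith-at pattern₂ x y j xⱼ≡true yⱼ≡false) *₁-after-i
         , subst-pattern₂ x y )
    where
    *₁-after-i : ∀ l → lookup (zipWith pattern₂ x y) l ≡ *₁ → i < l
    *₁-after-i l pₗ≡*₁ with pattern₂≡*₁ _ _ (trans (sym (lookup-zipWith pattern₂ l x y)) pₗ≡*₁)
    ... | xₗ≡true , yₗ≡false =
      Fin.≤∧≢⇒< (ℕ.≮⇒≥ λ l<i → true≢false (trans (sym xₗ≡true) (trans (prefix l l<i) yₗ≡false)))
                (λ { refl → true≢false (trans (sym xₗ≡true) xᵢ≡false) })

lexAB-total : {a b : Fin k} {w w′ : Word k n} → InAB a b w → InAB a b w′ → w ≢ w′ →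
  LexAB a b w w′ ⊎ LexAB a b w′ w
lexAB-total {w = w} {w′} w∈ab w′∈ab w≢w′ with first-mismatch _≟_ w w′ w≢w′
... | i , prefix , mismatch with w∈ab i | w′∈ab i
...   | inj₁ wᵢ≡a | inj₂ w′ᵢ≡b = inj₁ (i , prefix , wᵢ≡a , w′ᵢ≡b)
...   | inj₂ wᵢ≡b | inj₁ w′ᵢ≡a = inj₂ (i , (λ j j<i → sym (prefix j j<i)) , w′ᵢ≡a , wᵢ≡b)
...   | inj₁ wᵢ≡a | inj₁ w′ᵢ≡a = ⊥-elim (mismatch (trans wᵢ≡a (sym w′ᵢ≡a)))
...   | inj₂ wᵢ≡b | inj₂ w′ᵢ≡b = ⊥-elim (mismatch (trans wᵢ≡b (sym w′ᵢ≡b)))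

module _ {m : ℕ} {_≺_ : Word k (3 + m) → Word k (3 + m) → Set}
         (linear : IsLinearOrder _≺_) (uniform : IsUniform _≺_)
         {a b : Fin k} (a<b : induced _≺_ a b) where
  open IsLinearOrder linear renaming (trans to ≺-trans)

  a≢b : a ≢ b
  a≢b refl = irrefl _ a<b

  restrict₂-ab≺ba : (p : PWord k 2 (3 + m)) → IsCanonical p →
    restrict _≺_ p (a ∷ b ∷ []) (b ∷ a ∷ [])
  restrict₂-ab≺ba p canonical@(star , _)
    with total (subst p (a ∷ b ∷ [])) (subst p (b ∷ a ∷ []))
  ... | inj₁ ab≺ba = ab≺ba
  ... | inj₂ (inj₁ ab≡ba) = ⊥-elim (a≢b (a≡b (proj₁ (star zero)) (proj₂ (star zero))))
    where
    a≡b : ∀ i → lookup p i ≡ *₀ → a ≡ b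
    a≡b i pᵢ≡*₀ = begin
      a                                         ≡⟨ cong [ id , lookup (a ∷ b ∷ []) ] pᵢ≡*₀ ⟨
      [ id , lookup (a ∷ b ∷ []) ] (lookup p i) ≡⟨ lookup-subst p (a ∷ b ∷ []) i ⟨
      lookup (subst p (a ∷ b ∷ [])) i           ≡⟨ cong (λ u → lookup u i) ab≡ba ⟩
      lookup (subst p (b ∷ a ∷ [])) i           ≡⟨ lookup-subst p (b ∷ a ∷ []) i ⟩
      [ id , lookup (b ∷ a ∷ []) ] (lookup p i) ≡⟨ cong [ id , lookup (b ∷ a ∷ []) ] pᵢ≡*₀ ⟩
      b                                         ∎
  ... | inj₂ (inj₂ ba≺ab) =
    ⊥-elim (irrefl _ (≺-trans (≺-trans aab≺bab bab≺aba) (≺-trans aba≺bba bba≺aab)))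
    where
    ba≺ab-in : (q : PWord k 2 (3 + m)) → IsCanonical q → restrict _≺_ q (b ∷ a ∷ []) (a ∷ b ∷ [])
    ba≺ab-in q q-canonical =
      Equivalence.to (uniform 2 p q canonical q-canonical (b ∷ a ∷ []) (a ∷ b ∷ [])) ba≺ab

    a≺b-at-head : ∀ y z → triple a y z ≺ triple b y z
    a≺b-at-head y z =
      subst₂ _≺_ (subst-triple (a ∷ []) *₀ (inj₁ y) (inj₁ z))
                 (subst-triple (b ∷ []) *₀ (inj₁ y) (inj₁ z))
        (induced⇒restrict₁ _≺_ uniform a<b _ (canonical₁ (triple *₀ (inj₁ y) (inj₁ z)) zero refl))

    aab≺bab : triple a a b ≺ triple b a b
    aab≺bab = a≺b-at-head a b

    bab≺aba : triple b a b ≺ triple a b a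
    bab≺aba = subst₂ _≺_ (subst-triple (b ∷ a ∷ []) *₀ *₁ *₀) (subst-triple (a ∷ b ∷ []) *₀ *₁ *₀)
      (ba≺ab-in (triple *₀ *₁ *₀) (canonical₂-*₀∷ (*₁ ∷ *₀ ∷ replicate m *₀) zero refl))

    aba≺bba : triple a b a ≺ triple b b a
    aba≺bba = a≺b-at-head b a

    bba≺aab : triple b b a ≺ triple a a b
    bba≺aab = subst₂ _≺_ (subst-triple (b ∷ a ∷ []) *₀ *₀ *₁) (subst-triple (a ∷ b ∷ []) *₀ *₀ *₁)
      (ba≺ab-in (triple *₀ *₀ *₁) (canonical₂-*₀∷ (*₀ ∷ *₁ ∷ replicate m *₁) (suc zero) refl))

  lexAB⇒≺ : {w w′ : Word k (3 + m)} → InAB a b w → InAB a b w′ → LexAB a b w w′ → w ≺ w′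
  lexAB⇒≺ {w} {w′} w∈ab w′∈ab lex with InAB⇒binary a b w w∈ab | InAB⇒binary a b w′ w′∈ab
  ... | x , refl | y , refl with lexAB-binary a b a≢b x y lex
  ...   | i , prefix , xᵢ≡false , yᵢ≡true =
    [ image⇒≺ _≺_ (a ∷ []) (b ∷ []) (induced⇒restrict₁ _≺_ uniform a<b)
    , image⇒≺ _≺_ (a ∷ b ∷ []) (b ∷ a ∷ []) restrict₂-ab≺ba ]′
      (binary-lex⇒subcube-image a b x y i prefix xᵢ≡false yᵢ≡true)

proposition8 : (k n : ℕ) → n ≥ 3 →
    (_≺_ : Word k n → Word k n → Set) → IsLinearOrder _≺_ → IsUniform _≺_ →
    (a b : Fin k) → induced _≺_ a b →
    (w w' : Word k n) → InAB a b w → InAB a b w' → w ≢ w' →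
    (w ≺ w' ⇔ LexAB a b w w')
proposition8 k (suc (suc (suc m))) (s≤s (s≤s (s≤s z≤n)))
             _≺_ linear uniform a b a<b w w′ w∈ab w′∈ab w≢w′ =
  mk⇔ ≺⇒lexAB (lexAB⇒≺ linear uniform a<b w∈ab w′∈ab)
  where
  open IsLinearOrder linear renaming (trans to ≺-trans)
  ≺⇒lexAB : w ≺ w′ → LexAB a b w w′
  ≺⇒lexAB w≺w′ with lexAB-total w∈ab w′∈ab w≢w′
  ... | inj₁ lex  = lex
  ... | inj₂ lex′ = ⊥-elim (irrefl w (≺-trans w≺w′ (lexAB⇒≺ linear uniform a<b w′∈ab w∈ab lex′)))
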